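{- Let $N>1$ be an integer and $K=\lceil N^{1/6}\rceil$ (so $K\ge2$). Let $a,b$ be natural numbers such that $b\ge K^3$ and $b>a/K$. Let $a'=\lfloor a/K\rfloor$, $b'=\lceil b/K\rceil$ and $q=\lfloor a'/b'\rfloor$. Then (1) $q\le a/b<q+2$, i.e. $\lfloor a/b\rfloor=q$ or $\lfloor a/b\rfloor=q+1$; and (2) $b'>a'/K$. -}

module Defs where

open import Data.Nat using (ℕ; zero; suc; _+_; _*_; _∸_; _^_; _≤_; _<_; NonZero)
open import Data.Nat.DivMod using (_/_)

IsCeilSixthRoot : ℕ → ℕ → Set
IsCeilSixthRoot N K = (N ≤ K ^ 6) × ((K ∸ 1) ^ 6 < N)
  where open import Data.Product using (_×_)

ceilDiv : (m n : ℕ) → .{{NonZero n}} → ℕ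
ceilDiv m n = (m + (n ∸ 1)) / n

-- Write â = a′K and b̂ = b′K. Then â ≤ a < â + K and b ≤ b̂ < b + K, so the
-- bracket q b′ ≤ a′ < (q + 1) b′ scales to q b ≤ a < (q + 1)(b + K).  From
-- q b ≤ a < b K we get q < K, so the error (q + 1) K is at most K² ≤ b, giving
-- a < (q + 2) b.
module Submission where

open import Defs
open import Data.Nat using (ℕ; zero; suc; _+_; _*_; _∸_; _^_; _≤_; _<_; NonZero)
open import Data.Nat.DivMod using (_/_)
open import Data.Product using (_×_; _,_)
open import Data.Sum using (_⊎_)
open import Relation.Binary.PropositionalEquality using (_≡_)

open import Data.Nat using (s≤s; z<s; _%_; >-nonZero⁻¹)
open import Data.Nat.Properties
open import Data.Nat.DivMod using (m≡m%n+[m/n]*n; m%n<n; m/n*n≤m; m*n/n≡m; /-monoˡ-≤; m<n*o⇒m/o<n)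
open import Data.Sum using (inj₁; inj₂; map)
open import Relation.Binary.PropositionalEquality using (refl; sym; cong; subst)

m<[1+m/n]*n : ∀ m n .{{_ : NonZero n}} → m < suc (m / n) * n
m<[1+m/n]*n m n = begin-strict
  m                 ≡⟨ m≡m%n+[m/n]*n m n ⟩
  m % n + m / n * n <⟨ +-monoˡ-< (m / n * n) (m%n<n m n) ⟩
  n + m / n * n     ∎
  where open ≤-Reasoning

m≤ceilDiv[m,n]*n : ∀ m n .{{_ : NonZero n}} → m ≤ ceilDiv m n * n
m≤ceilDiv[m,n]*n m n = +-cancelʳ-≤ n m (ceilDiv m n * n) (begin
  m + n                 ≡⟨ cong (m +_) (sym (m∸n+n≡m (>-nonZero⁻¹ n))) ⟩
  m + (n ∸ 1 + 1)       ≡⟨ sym (+-assoc m (n ∸ 1) 1) ⟩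
  m + (n ∸ 1) + 1       ≡⟨ +-comm _ 1 ⟩
  suc (m + (n ∸ 1))     ≤⟨ m<[1+m/n]*n (m + (n ∸ 1)) n ⟩
  n + ceilDiv m n * n   ≡⟨ +-comm n _ ⟩
  ceilDiv m n * n + n   ∎)
  where open ≤-Reasoning

ceilDiv[m,n]*n<m+n : ∀ m n .{{_ : NonZero n}} → ceilDiv m n * n < m + n
ceilDiv[m,n]*n<m+n m n = begin-strict
  ceilDiv m n * n ≤⟨ m/n*n≤m (m + (n ∸ 1)) n ⟩
  m + (n ∸ 1)     <⟨ +-monoʳ-< m (∸-monoʳ-< z<s (>-nonZero⁻¹ n)) ⟩
  m + n           ∎
  where open ≤-Reasoning

between-q-and-q+1 : ∀ q x → q ≤ x → x < q + 2 → x ≡ q ⊎ x ≡ q + 1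
between-q-and-q+1 zero    zero          _         _               = inj₁ refl
between-q-and-q+1 zero    (suc zero)    _         _               = inj₂ refl
between-q-and-q+1 zero    (suc (suc x)) _         (s≤s (s≤s ()))
between-q-and-q+1 (suc q) (suc x)       (s≤s q≤x) (s≤s x<q+2)     =
  map (cong suc) (cong suc) (between-q-and-q+1 q x q≤x x<q+2)

/-bracket : ∀ {a b} q .{{_ : NonZero b}} → q * b ≤ a → a < (q + 2) * b →
            a / b ≡ q ⊎ a / b ≡ q + 1
/-bracket {a} {b} q qb≤a a<[q+2]b = between-q-and-q+1 q (a / b)
  (subst (_≤ a / b) (m*n/n≡m q b) (/-monoˡ-≤ b qb≤a))
  (m<n*o⇒m/o<n a<[q+2]b)

module ScaledQuotient {K a b a′ b′ q : ℕ}
  (a′K≤a : a′ * K ≤ a) (a<[1+a′]K : a < suc a′ * K)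
  (b≤b′K : b ≤ b′ * K) (b′K<b+K : b′ * K < b + K) where

  q*b≤a : q * b′ ≤ a′ → q * b ≤ a
  q*b≤a qb′≤a′ = begin
    q * b         ≤⟨ *-monoʳ-≤ q b≤b′K ⟩
    q * (b′ * K)  ≡⟨ sym (*-assoc q b′ K) ⟩
    q * b′ * K    ≤⟨ *-monoˡ-≤ K qb′≤a′ ⟩
    a′ * K        ≤⟨ a′K≤a ⟩
    a             ∎
    where open ≤-Reasoning

  a<[1+q]*[b+K] : a′ < suc q * b′ → a < suc q * (b + K)
  a<[1+q]*[b+K] a′<[1+q]b′ = begin-strict
    a                   <⟨ a<[1+a′]K ⟩
    suc a′ * K          ≤⟨ *-monoˡ-≤ K a′<[1+q]b′ ⟩
    suc q * b′ * K      ≡⟨ *-assoc (suc q) b′ K ⟩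
    suc q * (b′ * K)    ≤⟨ *-monoʳ-≤ (suc q) (<⇒≤ b′K<b+K) ⟩
    suc q * (b + K)     ∎
    where open ≤-Reasoning

  a<[q+2]*b : K * K ≤ b → a < b * K → q * b ≤ a → a′ < suc q * b′ → a < (q + 2) * b
  a<[q+2]*b KK≤b a<bK qb≤a a′<[1+q]b′ = begin-strict
    a                       <⟨ a<[1+q]*[b+K] a′<[1+q]b′ ⟩
    suc q * (b + K)         ≡⟨ *-distribˡ-+ (suc q) b K ⟩
    suc q * b + suc q * K   ≤⟨ +-monoʳ-≤ (suc q * b) (≤-trans (*-monoˡ-≤ K q<K) KK≤b) ⟩
    suc q * b + b           ≡⟨ +-comm (suc q * b) b ⟩
    suc (suc q) * b         ≡⟨ cong (_* b) (+-comm 2 q) ⟩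
    (q + 2) * b             ∎
    where
    open ≤-Reasoning
    q<K : q < K
    q<K = *-cancelʳ-< b q K (≤-<-trans qb≤a (subst (a <_) (*-comm b K) a<bK))

  a′<b′*K : a < b * K → a′ < b′ * K
  a′<b′*K a<bK = *-cancelʳ-< K a′ (b′ * K) (begin-strict
    a′ * K      ≤⟨ a′K≤a ⟩
    a           <⟨ a<bK ⟩
    b * K       ≤⟨ *-monoˡ-≤ K b≤b′K ⟩
    b′ * K * K  ∎)
    where open ≤-Reasoning

n*n≤n^3 : ∀ n .{{_ : NonZero n}} → n * n ≤ n ^ 3
n*n≤n^3 n = subst (n * n ≤_) n*n*n≡n^3 (m≤m*n (n * n) n)
  where
  n*n*n≡n^3 : n * n * n ≡ n ^ 3
  n*n*n≡n^3 rewrite *-identityʳ n = *-assoc n n n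

lemma5p1 : (N K a b : ℕ) → 1 < N → IsCeilSixthRoot N K →
    .{{nzK : NonZero K}} → .{{nzb : NonZero b}} →
    K ^ 3 ≤ b → a < b * K →
    let a′ = a / K
        b′ = ceilDiv b K
    in (nzb′ : NonZero b′) →
    let q = (a′ / b′) {{nzb′}}
    in ((q * b ≤ a) × (a < (q + 2) * b))
       × ((a / b ≡ q) ⊎ (a / b ≡ q + 1))
       × (a′ < b′ * K)
lemma5p1 N K a b _ _ K³≤b a<bK nzb′ =
  (qb≤a , a<[q+2]b) , /-bracket q qb≤a a<[q+2]b , a′<b′*K a<bK
  where
  a′ b′ q : ℕ
  a′ = a / K
  b′ = ceilDiv b K
  q = (a′ / b′) {{nzb′}}
  open ScaledQuotient {a′ = a′} {b′ = b′} {q = q}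
    (m/n*n≤m a K) (m<[1+m/n]*n a K) (m≤ceilDiv[m,n]*n b K) (ceilDiv[m,n]*n<m+n b K)
  qb≤a : q * b ≤ a
  qb≤a = q*b≤a (m/n*n≤m a′ b′ {{nzb′}})
  a<[q+2]b : a < (q + 2) * b
  a<[q+2]b = a<[q+2]*b (≤-trans (n*n≤n^3 K) K³≤b) a<bK qb≤a (m<[1+m/n]*n a′ b′ {{nzb′}})
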